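{- Exhaustive pure literal elimination is symmetry-preserving: for all CNF formulas $F$ and $F^*$ such that $F^*$ is obtained from $F$ by applying the pure literal rule until it is no longer applicable, we have $\mathrm{Aut}_{\mathrm{syn}}(F)_{\{\mathrm{Lit}(F^*)\}}=\mathrm{Aut}_{\mathrm{syn}}(F)$ and $\mathrm{Aut}_{\mathrm{syn}}(F)\downarrow_{\mathrm{Lit}(F^*)}\subseteq\mathrm{Aut}_{\mathrm{syn}}(F^*)$.
   Context: Literals: each variable $v$ gives literals $v,\bar v$ with $\bar{\bar v}=v$. A CNF formula $F$ is a finite set of clauses, each a finite set of literals; $\mathrm{Var}(F)$ is the set of variables occurring in $F$, $\mathrm{Lit}(F):=\mathrm{Var}(F)\cup\{\bar v:v\in\mathrm{Var}(F)\}$. For a literal $l$, $F[l\mapsto\top]:=\{C\setminus\{\bar l\}: C\in F,\ l\notin C\}$. Bijections of literals act elementwise on clauses and formulas. A syntactic symmetry of $F$ is a bijection $\varphi:\mathrm{Lit}(F)\to\mathrm{Lit}(F)$ with $\varphi(F)=F$ and $\overline{\varphi(l)}=\varphi(\bar l)$ for all $l$; these form the group $\mathrm{Aut}_{\mathrm{syn}}(F)$. For a permutation group $\Gamma$ on $\Omega$ and $\Omega'\subseteq\Omega$: $\Gamma_{\{\Omega'\}}:=\{\varphi\in\Gamma:\varphi(\Omega')=\Omega'\}$ and $\Gamma\downarrow_{\Omega'}:=\{\varphi|_{\Omega'}:\varphi\in\Gamma_{\{\Omega'\}}\}$. Pure literal rule: if $l\in\mathrm{Lit}(F)$ is such that $\bar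 l\notin C$ for every $C\in F$, transform $F$ into $F[l\mapsto\top]$. -}

module Defs where

open import Data.Nat using (ℕ)
import Data.Nat.Properties as ℕP
open import Data.Bool using (Bool; true; false)
open import Data.List using (List; map; filter)
open import Data.List.Membership.Propositional using (_∈_; _∉_)
open import Data.List.Membership.DecPropositional using () renaming (_∈?_ to ∈?-dec)
open import Data.Product using (Σ; ∃; _×_; _,_)
open import Data.Sum using (_⊎_)
open import Relation.Nullary using (¬_; Dec; yes; no; ¬?)

open import Relation.Binary.PropositionalEquality using (_≡_; _≢_; refl; cong)
open import Relation.Binary using (DecidableEquality)
open import Function.Bundles using (_⇔_)

Var : Set
Var = ℕ

data Lit : Set where
  pos : Var → Lit
  neg : Var → Lit

var : Lit → Var
var (pos v) = v
var (neg v) = v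

‾ : Lit → Lit
‾ (pos v) = neg v
‾ (neg v) = pos v

_≟L_ : DecidableEquality Lit
pos x ≟L pos y with x ℕP.≟ y
... | yes refl = yes refl
... | no ne = no λ { refl → ne refl }
pos x ≟L neg y = no λ ()
neg x ≟L pos y = no λ ()
neg x ≟L neg y with x ℕP.≟ y
... | yes refl = yes refl
... | no ne = no λ { refl → ne refl }

-- Clauses and formulas are finite sets, represented by lists and
-- compared extensionally (via membership).
Clause : Set
Clause = List Lit

Formula : Set
Formula = List Clause

_≈C_ : Clause → Clause → Set
C ≈C D = ∀ l → (l ∈ C) ⇔ (l ∈ D)

_∈F_ : Clause → Formula → Set
C ∈F F = Σ Clause λ D → (D ∈ F) × (C ≈C D)

_≈F_ : Formula → Formula → Set
F ≈F G = ∀ C → (C ∈F F) ⇔ (C ∈F G)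

_∈Var_ : Var → Formula → Set
v ∈Var F = Σ Clause λ C → (C ∈ F) × ((pos v ∈ C) ⊎ (neg v ∈ C))

_∈Lit_ : Lit → Formula → Set
l ∈Lit F = var l ∈Var F

_[_↦⊤] : Formula → Lit → Formula
F [ l ↦⊤] =
  map (filter (λ m → ¬? (m ≟L ‾ l)))
      (filter (λ C → ¬? (∈?-dec _≟L_ l C)) F)

Pure : Formula → Lit → Set
Pure F l = (l ∈Lit F) × (∀ C → C ∈ F → ‾ l ∉ C)

data PLStep : Formula → Formula → Set where
  step : ∀ {F} l → Pure F l → PLStep F (F [ l ↦⊤])

data PLSteps : Formula → Formula → Set where
  done : ∀ {F} → PLSteps F F
  more : ∀ {F G H} → PLStep F G → PLSteps G H → PLSteps F H

ExhaustivePLE : Formula → Formula → Set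
ExhaustivePLE F F* = PLSteps F F* × (¬ Σ Lit λ l → Pure F* l)

mapC : (Lit → Lit) → Clause → Clause
mapC φ C = map φ C

mapF : (Lit → Lit) → Formula → Formula
mapF φ F = map (mapC φ) F

IsBijOnLit : Formula → (Lit → Lit) → Set
IsBijOnLit F φ =
  (∀ l → l ∈Lit F → φ l ∈Lit F) ×
  (∀ l m → l ∈Lit F → m ∈Lit F → φ l ≡ φ m → l ≡ m) ×
  (∀ m → m ∈Lit F → Σ Lit λ l → (l ∈Lit F) × (φ l ≡ m))

-- φ (restricted to Lit(F)) is a syntactic symmetry of F.
-- Only the values of φ on Lit(F) matter.
IsSynSym : Formula → (Lit → Lit) → Set
IsSynSym F φ =
  IsBijOnLit F φ ×
  (∀ l → l ∈Lit F → ‾ (φ l) ≡ φ (‾ l)) ×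
  (mapF φ F ≈F F)

StabilizesLit : Formula → (Lit → Lit) → Set
StabilizesLit G φ =
  (∀ l → l ∈Lit G → φ l ∈Lit G) ×
  (∀ m → m ∈Lit G → Σ Lit λ l → (l ∈Lit G) × (φ l ≡ m))

-- Call a family S of clauses of G complement-closed if every literal of a
-- member of S has its complement in some member of S. No literal of such a
-- family is pure in G, so a pure literal step neither deletes a member nor
-- shrinks it: complement-closed subfamilies of F survive into F*. Since F*
-- has no pure literal, F* itself is complement-closed, and so are its image
-- and preimage under a symmetry φ of F. Hence φ maps F* onto itself.

module Submission where

open import Defs
open import Level using (0ℓ)
open import Data.Empty using (⊥-elim)
open import Data.Product using (_×_; Σ; ∃; _,_; proj₁; proj₂)
open import Data.Sum using (inj₁; inj₂) renaming (map to ⊎-map)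
open import Data.List using (filter)
open import Data.List.Relation.Unary.Any using (any?)
open import Data.List.Membership.Propositional using (_∈_; _∉_; find; lose)
open import Data.List.Membership.Propositional.Properties
  using (∈-map⁺; ∈-map⁻; ∈-filter⁺; ∈-filter⁻)
open import Data.List.Membership.DecPropositional using () renaming (_∈?_ to ∈?-dec)
open import Relation.Nullary using (¬_; ¬?)
open import Relation.Nullary.Decidable using (yes; no)
open import Relation.Unary using (Pred)
open import Relation.Binary.PropositionalEquality using (_≡_; refl; sym; trans; subst)
open import Function.Bundles using (mk⇔; Equivalence)
open import Function.Construct.Identity using (⇔-id)
open import Function.Construct.Symmetry using (⇔-sym)
open import Function.Construct.Composition using (_⇔-∘_)
open Equivalence using (to; from)

≈C-refl : ∀ {C} → C ≈C C
≈C-refl l = ⇔-id _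

≈C-sym : ∀ {C D} → C ≈C D → D ≈C C
≈C-sym C≈D l = ⇔-sym (C≈D l)

≈C-trans : ∀ {C D E} → C ≈C D → D ≈C E → C ≈C E
≈C-trans C≈D D≈E l = D≈E l ⇔-∘ C≈D l

mapC-cong : ∀ φ {C D} → C ≈C D → mapC φ C ≈C mapC φ D
mapC-cong φ C≈D l = mk⇔ (transport C≈D) (transport (≈C-sym C≈D))
  where
  transport : ∀ {C D} → C ≈C D → l ∈ mapC φ C → l ∈ mapC φ D
  transport C≈D l∈φC with ∈-map⁻ φ l∈φC
  ... | k , k∈C , refl = ∈-map⁺ φ (to (C≈D k) k∈C)

∈⇒∈F : ∀ {C G} → C ∈ G → C ∈F G
∈⇒∈F C∈G = _ , C∈G , ≈C-refl

∈F-resp-≈C : ∀ {C D G} → C ≈C D → D ∈F G → C ∈F G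
∈F-resp-≈C C≈D (E , E∈G , D≈E) = E , E∈G , ≈C-trans C≈D D≈E

∈⇒∈Lit : ∀ {l C G} → l ∈ C → C ∈ G → l ∈Lit G
∈⇒∈Lit {pos v} l∈C C∈G = _ , C∈G , inj₁ l∈C
∈⇒∈Lit {neg v} l∈C C∈G = _ , C∈G , inj₂ l∈C

∈F⇒∈Lit : ∀ {l C G} → l ∈ C → C ∈F G → l ∈Lit G
∈F⇒∈Lit {l} l∈C (D , D∈G , C≈D) = ∈⇒∈Lit (to (C≈D l) l∈C) D∈G

‾-∈Lit : ∀ {l G} → l ∈Lit G → ‾ l ∈Lit G
‾-∈Lit {pos v} l∈G = l∈G
‾-∈Lit {neg v} l∈G = l∈G

_⊆F_ : Pred Clause 0ℓ → Formula → Set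
S ⊆F G = ∀ {D} → S D → D ∈F G

∈F-⊆F : ∀ {C H G} → C ∈F H → (_∈ H) ⊆F G → C ∈F G
∈F-⊆F (D , D∈H , C≈D) H⊆G = ∈F-resp-≈C C≈D (H⊆G D∈H)

∈Lit-⊆F : ∀ {l H G} → (_∈ H) ⊆F G → l ∈Lit H → l ∈Lit G
∈Lit-⊆F H⊆G (C , C∈H , occurs) with H⊆G C∈H
... | D , D∈G , C≈D = D , D∈G , ⊎-map (to (C≈D _)) (to (C≈D _)) occurs

ComplementClosed : Pred Clause 0ℓ → Set
ComplementClosed S = ∀ {D l} → S D → l ∈ D → ∃ λ D' → S D' × ‾ l ∈ D'

noPure⇒ComplementClosed : ∀ {G} → ¬ Σ Lit (Pure G) → ComplementClosed (_∈ G)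
noPure⇒ComplementClosed {G} noPure {D} {l} D∈G l∈D with any? (∈?-dec _≟L_ (‾ l)) G
... | yes ‾l∈some = find ‾l∈some
... | no ‾l∈none =
  ⊥-elim (noPure (l , ∈⇒∈Lit l∈D D∈G , λ C C∈G ‾l∈C → ‾l∈none (lose C∈G ‾l∈C)))

closed-∈Lit⇒occurs : ∀ {G l} → ComplementClosed (_∈ G) → l ∈Lit G →
                     ∃ λ C → C ∈ G × l ∈ C
closed-∈Lit⇒occurs {l = pos v} closed (C , C∈G , inj₁ l∈C) = C , C∈G , l∈C
closed-∈Lit⇒occurs {l = pos v} closed (C , C∈G , inj₂ ‾l∈C) = closed C∈G ‾l∈C
closed-∈Lit⇒occurs {l = neg v} closed (C , C∈G , inj₁ ‾l∈C) = closed C∈G ‾l∈C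
closed-∈Lit⇒occurs {l = neg v} closed (C , C∈G , inj₂ l∈C) = C , C∈G , l∈C

filter-≢-≈C : ∀ m E → m ∉ E → filter (λ x → ¬? (x ≟L m)) E ≈C E
filter-≢-≈C m E m∉E l =
  mk⇔ (λ l∈ → proj₁ (∈-filter⁻ (λ x → ¬? (x ≟L m)) l∈))
      (λ l∈E → ∈-filter⁺ (λ x → ¬? (x ≟L m)) l∈E (λ { refl → m∉E l∈E }))

pure-∉-closed : ∀ {G S l} → Pure G l → ComplementClosed S → S ⊆F G →
                ∀ {D} → S D → l ∉ D
pure-∉-closed (_ , ‾l∉G) closed S⊆G SD l∈D with closed SD l∈D
... | D' , SD' , ‾l∈D' with S⊆G SD'
...   | E , E∈G , D'≈E = ‾l∉G E E∈G (to (D'≈E _) ‾l∈D')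

closed-⊆F-step : ∀ {G H S} → PLStep G H → ComplementClosed S → S ⊆F G → S ⊆F H
closed-⊆F-step (step l l-pure@(_ , ‾l∉G)) closed S⊆G SD with S⊆G SD
... | E , E∈G , D≈E =
  filter (λ m → ¬? (m ≟L ‾ l)) E ,
  ∈-map⁺ _ (∈-filter⁺ (λ C → ¬? (∈?-dec _≟L_ l C)) E∈G l∉E) ,
  ≈C-trans D≈E (≈C-sym (filter-≢-≈C (‾ l) E (‾l∉G E E∈G)))
  where
  l∉E : l ∉ E
  l∉E l∈E = pure-∉-closed l-pure closed S⊆G SD (from (D≈E l) l∈E)

closed-⊆F-steps : ∀ {G H S} → PLSteps G H → ComplementClosed S → S ⊆F G → S ⊆F H
closed-⊆F-steps done        closed S⊆G = S⊆G
closed-⊆F-steps (more s ss) closed S⊆G =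
  closed-⊆F-steps ss closed (closed-⊆F-step s closed S⊆G)

step-⊆F : ∀ {G H} → PLStep G H → (_∈ H) ⊆F G
step-⊆F (step l (_ , ‾l∉G)) C∈H with ∈-map⁻ (filter (λ m → ¬? (m ≟L ‾ l))) C∈H
... | E , E∈kept , refl with ∈-filter⁻ (λ C → ¬? (∈?-dec _≟L_ l C)) E∈kept
...   | E∈G , _ = E , E∈G , filter-≢-≈C (‾ l) E (‾l∉G E E∈G)

steps-⊆F : ∀ {G H} → PLSteps G H → (_∈ H) ⊆F G
steps-⊆F done        C∈G = ∈⇒∈F C∈G
steps-⊆F (more s ss) C∈H = ∈F-⊆F (steps-⊆F ss C∈H) (step-⊆F s)

≈F-image : ∀ {φ G C} → mapF φ G ≈F G → C ∈F G → mapC φ C ∈F G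
≈F-image {φ} {G} φG≈G (D , D∈G , C≈D) =
  ∈F-resp-≈C (mapC-cong φ C≈D)
             (to (φG≈G (mapC φ D)) (∈⇒∈F (∈-map⁺ (mapC φ) D∈G)))

≈F-preimage : ∀ {φ G C} → mapF φ G ≈F G → C ∈F G →
              ∃ λ D → D ∈ G × C ≈C mapC φ D
≈F-preimage {φ} {G} {C} φG≈G C∈G with from (φG≈G C) C∈G
... | Y , Y∈φG , C≈Y with ∈-map⁻ (mapC φ) Y∈φG
...   | D , D∈G , refl = D , D∈G , C≈Y

image-preimage⇒≈F : ∀ {φ G} →
  (∀ {C} → C ∈ G → mapC φ C ∈F G) →
  (∀ {C} → C ∈F G → ∃ λ D → D ∈ G × C ≈C mapC φ D) →
  mapF φ G ≈F G
image-preimage⇒≈F {φ} image preimage C = mk⇔ into onto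
  where
  into : C ∈F mapF φ _ → C ∈F _
  into (Y , Y∈φG , C≈Y) with ∈-map⁻ (mapC φ) Y∈φG
  ... | D , D∈G , refl = ∈F-resp-≈C C≈Y (image D∈G)
  onto : C ∈F _ → C ∈F mapF φ _
  onto C∈G with preimage C∈G
  ... | D , D∈G , C≈φD = mapC φ D , ∈-map⁺ (mapC φ) D∈G , C≈φD

≈F⇒StabilizesLit : ∀ {φ G} → ComplementClosed (_∈ G) → mapF φ G ≈F G →
                   StabilizesLit G φ
≈F⇒StabilizesLit {φ} closed φG≈G = maps-into , onto
  where
  maps-into : ∀ l → l ∈Lit _ → φ l ∈Lit _
  maps-into l l∈G with closed-∈Lit⇒occurs closed l∈G
  ... | C , C∈G , l∈C = ∈F⇒∈Lit (∈-map⁺ φ l∈C) (≈F-image φG≈G (∈⇒∈F C∈G))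
  onto : ∀ m → m ∈Lit _ → Σ Lit λ l → (l ∈Lit _) × (φ l ≡ m)
  onto m m∈G with closed-∈Lit⇒occurs closed m∈G
  ... | C , C∈G , m∈C with ≈F-preimage φG≈G (∈⇒∈F C∈G)
  ...   | D , D∈G , C≈φD with ∈-map⁻ φ (to (C≈φD m) m∈C)
  ...     | k , k∈D , m≡φk = k , ∈⇒∈Lit k∈D D∈G , sym m≡φk

module SynSym {F φ} (φ-sym : IsSynSym F φ) where

  private
    φ-injective : ∀ {l m} → l ∈Lit F → m ∈Lit F → φ l ≡ φ m → l ≡ m
    φ-injective = proj₁ (proj₂ (proj₁ φ-sym)) _ _

    φ-‾ : ∀ l → l ∈Lit F → ‾ (φ l) ≡ φ (‾ l)
    φ-‾ = proj₁ (proj₂ φ-sym)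

    φF≈F : mapF φ F ≈F F
    φF≈F = proj₂ (proj₂ φ-sym)

  Image : Pred Clause 0ℓ → Pred Clause 0ℓ
  Image S E = ∃ λ C → S C × E ≈C mapC φ C

  Preimage : Formula → Pred Clause 0ℓ
  Preimage G D = D ∈F F × mapC φ D ∈F G

  image-⊆F : ∀ {S} → S ⊆F F → Image S ⊆F F
  image-⊆F S⊆F (C , SC , E≈φC) = ∈F-resp-≈C E≈φC (≈F-image φF≈F (S⊆F SC))

  image-closed : ∀ {S} → S ⊆F F → ComplementClosed S → ComplementClosed (Image S)
  image-closed S⊆F closed (C , SC , E≈φC) l∈E with ∈-map⁻ φ (to (E≈φC _) l∈E)
  ... | k , k∈C , refl with closed SC k∈C
  ...   | C' , SC' , ‾k∈C' =
    mapC φ C' , (C' , SC' , ≈C-refl) ,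
    subst (_∈ mapC φ C') (sym (φ-‾ k (∈F⇒∈Lit k∈C (S⊆F SC)))) (∈-map⁺ φ ‾k∈C')

  preimage-closed : ∀ {G} → (_∈ G) ⊆F F → ComplementClosed (_∈ G) →
                    ComplementClosed (Preimage G)
  preimage-closed G⊆F closed {D} {l} (D∈F , C , C∈G , φD≈C) l∈D
    with closed C∈G (to (φD≈C (φ l)) (∈-map⁺ φ l∈D))
  ... | C' , C'∈G , ‾φl∈C' with ≈F-preimage φF≈F (G⊆F C'∈G)
  ...   | D' , D'∈F , C'≈φD' with ∈-map⁻ φ (to (C'≈φD' _) ‾φl∈C')
  ...     | k , k∈D' , ‾φl≡φk =
    D' , (∈⇒∈F D'∈F , C' , C'∈G , ≈C-sym C'≈φD') , subst (_∈ D') (sym ‾l≡k) k∈D'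
    where
    l∈F : l ∈Lit F
    l∈F = ∈F⇒∈Lit l∈D D∈F
    ‾l≡k : ‾ l ≡ k
    ‾l≡k = φ-injective (‾-∈Lit {l} l∈F) (∈⇒∈Lit k∈D' D'∈F) (trans (sym (φ-‾ l l∈F)) ‾φl≡φk)

  module _ {F*} (steps : PLSteps F F*) (closed : ComplementClosed (_∈ F*)) where

    image-∈F* : ∀ {C} → C ∈ F* → mapC φ C ∈F F*
    image-∈F* C∈F* =
      closed-⊆F-steps steps (image-closed (steps-⊆F steps) closed)
                      (image-⊆F (steps-⊆F steps)) (_ , C∈F* , ≈C-refl)

    preimage-∈F* : ∀ {C} → C ∈F F* → ∃ λ D → D ∈ F* × C ≈C mapC φ D
    preimage-∈F* C∈F* with ≈F-preimage φF≈F (∈F-⊆F C∈F* (steps-⊆F steps))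
    ... | D , D∈F , C≈φD
      with closed-⊆F-steps steps (preimage-closed (steps-⊆F steps) closed) proj₁
             (∈⇒∈F D∈F , ∈F-resp-≈C (≈C-sym C≈φD) C∈F*)
    ...   | D* , D*∈F* , D≈D* = D* , D*∈F* , ≈C-trans C≈φD (mapC-cong φ D≈D*)

    mapF-≈F* : mapF φ F* ≈F F*
    mapF-≈F* = image-preimage⇒≈F image-∈F* preimage-∈F*

lemma7 : (F F* : Formula) → ExhaustivePLE F F* →
         (φ : Lit → Lit) → IsSynSym F φ →
         StabilizesLit F* φ × IsSynSym F* φ
lemma7 F F* (steps , noPure) φ φ-sym@((_ , φ-injective , _) , φ-‾ , _) =
  stabilizes , (maps-into , injective , onto) , (λ l l∈F* → φ-‾ l (F*⊆F l l∈F*)) , φF*≈F*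
  where
  closed : ComplementClosed (_∈ F*)
  closed = noPure⇒ComplementClosed noPure

  φF*≈F* : mapF φ F* ≈F F*
  φF*≈F* = SynSym.mapF-≈F* φ-sym steps closed

  stabilizes : StabilizesLit F* φ
  stabilizes = ≈F⇒StabilizesLit closed φF*≈F*

  maps-into : ∀ l → l ∈Lit F* → φ l ∈Lit F*
  maps-into = proj₁ stabilizes

  onto : ∀ m → m ∈Lit F* → Σ Lit λ l → (l ∈Lit F*) × (φ l ≡ m)
  onto = proj₂ stabilizes

  F*⊆F : ∀ l → l ∈Lit F* → l ∈Lit F
  F*⊆F l = ∈Lit-⊆F {l} (steps-⊆F steps)

  injective : ∀ l m → l ∈Lit F* → m ∈Lit F* → φ l ≡ φ m → l ≡ m
  injective l m l∈F* m∈F* = φ-injective l m (F*⊆F l l∈F*) (F*⊆F m m∈F*)
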